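{- Let $M$ be the output of $\mathcal{LS}$ on an MCBM instance $G$ and $M^*$ a maximum compatible matching of $G$. If $e\in M$ is a parallel (i.e., non-singleton) edge of $M$, then $\omega(e)<3$.
   Context: MCBM: $G=(D^A,D^B,E)$ bipartite with $D^A=\{d^A_1,\dots,d^A_{n-1}\}$, $D^B=\{d^B_1,\dots,d^B_{n-1}\}$, $e_{i,j}$ the edge between $d^A_i$ and $d^B_j$. Two distinct edges conflict if (i) they share an endpoint, or (ii) they are $e_{i,j}$ and $e_{i+1,j'}$ with $j'\ne j+1$, or (iii) they are $e_{i,j}$ and $e_{i',j+1}$ with $i'\ne i+1$; otherwise compatible. A compatible matching is a set of pairwise compatible edges. Edges $e_{i,j}$, $e_{i+1,j+1}$ are parallel; an edge of a compatible matching $M$ is a singleton if parallel to no other edge of $M$, and a parallel edge of $M$ otherwise; $s(M)$ is the set of singletons. Algorithm $\mathcal{LS}$: start from $M=\emptyset$; repeatedly (1) greedily extend $M$ to a maximal compatible matching; (2) Replace-5-by-6: if $|M|\le5$ search exhaustively for a compatible matching of size $|M|+1$; else for some $5$-element $X\subseteq M$, with $C(X)$ the set of edges conflicting with some edge of $X$ and compatible with all of $M\setminus X$, replace $X$ by a $6$-element pairwise compatible $X'\subseteq X\cup C(X)$ if one exists; (3) if (2) fails, Reduce-5-by-5: if $|M|\le5$ search exhaustively for a compatible matching of size $|M|$ with fewer singletons; else replace some $5$-element $X\subseteq M$ by a $5$-element pairwise compatible $X'\subseteq X\cup C(X)$ with $|s((M\setminus X)\cup X')|<|s(M)|$ if one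 exists; (4) if both fail, output $M$. Notation: an edge is regarded as conflicting with itself. For $e^*\in M^*$, $C(e^*)$ is the set of edges of $M$ conflicting with $e^*$; for $e\in M$, $C^*(e)$ is the set of edges of $M^*$ conflicting with $e$, and $\omega(e)=\sum_{e^*\in C^*(e)}\frac{1}{|C(e^*)|}$. -}

module Defs where

open import Data.Nat as ℕ using (ℕ; zero; suc)
open import Data.Fin using (Fin; toℕ)
open import Data.Product using (Σ; _×_; _,_; ∃; ∃-syntax; proj₁; proj₂)
open import Data.Product.Properties using (≡-dec)
open import Data.Sum using (_⊎_; inj₁; inj₂)
open import Data.List using (List; []; _∷_; length; filter; _++_; map)
open import Data.List.Relation.Unary.All using (All)
open import Data.List.Relation.Unary.Any using (Any; any?)
open import Data.List.Relation.Unary.AllPairs using (AllPairs)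
open import Data.List.Relation.Unary.Unique.Propositional using (Unique)
open import Data.Rational as ℚ using (ℚ; 0ℚ)
open import Data.Integer using (+_)
open import Relation.Nullary using (¬_; Dec; yes; no)
open import Relation.Nullary.Decidable using (_×-dec_; _⊎-dec_; ¬?)
open import Relation.Binary.PropositionalEquality using (_≡_; _≢_)
import Data.Fin.Properties as FinP
import Data.Nat.Properties as NatP

-- MCBM instances.  D^A = {d^A_1..d^A_m}, D^B = {d^B_1..d^B_m} with m = n-1;
-- vertex d^A_{k+1} is represented by k : Fin m (0-based), same for D^B.
-- The edge e_{i,j} is the pair (i , j).

Edge : ℕ → Set
Edge m = Fin m × Fin m

_≟E_ : ∀ {m} (e f : Edge m) → Dec (e ≡ f)
_≟E_ = ≡-dec FinP._≟_ FinP._≟_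

open import Data.List.Membership.Propositional public using (_∈_; _∉_)

_∈?_ : ∀ {m} (e : Edge m) (L : List (Edge m)) → Dec (e ∈ L)
e ∈? L = any? (e ≟E_) L

Succ : ∀ {m} → Fin m → Fin m → Set
Succ a b = toℕ a ≡ suc (toℕ b)

Succ? : ∀ {m} (a b : Fin m) → Dec (Succ a b)
Succ? a b = toℕ a NatP.≟ suc (toℕ b)

-- The raw conflict condition (i)-(iii) between e = e_{i,j} and f = e_{i',j'},
-- read for the unordered pair {e , f}.
ConflictCore : ∀ {m} → Edge m → Edge m → Set
ConflictCore (i , j) (i' , j') =
    (i ≡ i' ⊎ j ≡ j')
  ⊎ (Succ i' i × ¬ Succ j' j) ⊎ (Succ i i' × ¬ Succ j j')
  ⊎ (Succ j' j × ¬ Succ i' i) ⊎ (Succ j j' × ¬ Succ i i')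

Conflicting : ∀ {m} → Edge m → Edge m → Set
Conflicting e f = e ≢ f × ConflictCore e f

Compatible : ∀ {m} → Edge m → Edge m → Set
Compatible e f = ¬ Conflicting e f

ConflictingSelf : ∀ {m} → Edge m → Edge m → Set
ConflictingSelf e f = e ≡ f ⊎ Conflicting e f

ConflictCore? : ∀ {m} (e f : Edge m) → Dec (ConflictCore e f)
ConflictCore? (i , j) (i' , j') =
     (i FinP.≟ i' ⊎-dec j FinP.≟ j')
  ⊎-dec (Succ? i' i ×-dec ¬? (Succ? j' j)) ⊎-dec (Succ? i i' ×-dec ¬? (Succ? j j'))
  ⊎-dec (Succ? j' j ×-dec ¬? (Succ? i' i)) ⊎-dec (Succ? j j' ×-dec ¬? (Succ? i i'))

Conflicting? : ∀ {m} (e f : Edge m) → Dec (Conflicting e f)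
Conflicting? e f = ¬? (e ≟E f) ×-dec ConflictCore? e f

ConflictingSelf? : ∀ {m} (e f : Edge m) → Dec (ConflictingSelf e f)
ConflictingSelf? e f = (e ≟E f) ⊎-dec Conflicting? e f

PairwiseCompatible : ∀ {m} → List (Edge m) → Set
PairwiseCompatible L = Unique L × AllPairs Compatible L

IsCompatibleMatching : ∀ {m} → List (Edge m) → List (Edge m) → Set
IsCompatibleMatching E M = All (_∈ E) M × PairwiseCompatible M

IsMaximumCM : ∀ {m} → List (Edge m) → List (Edge m) → Set
IsMaximumCM E M* = IsCompatibleMatching E M*
  × (∀ N → IsCompatibleMatching E N → length N ℕ.≤ length M*)

IsMaximalCM : ∀ {m} → List (Edge m) → List (Edge m) → Set
IsMaximalCM E M = IsCompatibleMatching E M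
  × (∀ f → f ∈ E → f ∉ M → ¬ IsCompatibleMatching E (f ∷ M))

Parallel : ∀ {m} → Edge m → Edge m → Set
Parallel (i , j) (i' , j') = (Succ i' i × Succ j' j) ⊎ (Succ i i' × Succ j j')

Parallel? : ∀ {m} (e f : Edge m) → Dec (Parallel e f)
Parallel? (i , j) (i' , j') = (Succ? i' i ×-dec Succ? j' j) ⊎-dec (Succ? i i' ×-dec Succ? j j')

IsParallelEdge : ∀ {m} → List (Edge m) → Edge m → Set
IsParallelEdge M e = e ∈ M × Any (Parallel e) M

IsSingletonIn : ∀ {m} → List (Edge m) → Edge m → Set
IsSingletonIn M e = ¬ Any (Parallel e) M

IsSingletonIn? : ∀ {m} (M : List (Edge m)) (e : Edge m) → Dec (IsSingletonIn M e)
IsSingletonIn? M e = ¬? (any? (Parallel? e) M)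

singletons : ∀ {m} → List (Edge m) → List (Edge m)
singletons M = filter (IsSingletonIn? M) M

minus : ∀ {m} → List (Edge m) → List (Edge m) → List (Edge m)
minus M X = filter (λ e → ¬? (e ∈? X)) M

Is5Subset : ∀ {m} → List (Edge m) → List (Edge m) → Set
Is5Subset M X = Unique X × All (_∈ M) X × length X ≡ 5

InC : ∀ {m} → List (Edge m) → List (Edge m) → List (Edge m) → Edge m → Set
InC E M X f = f ∈ E × Any (Conflicting f) X × All (Compatible f) (minus M X)

IsReplacement : ∀ {m} → List (Edge m) → List (Edge m) → List (Edge m)
  → ℕ → List (Edge m) → Set
IsReplacement E M X k X' =
  PairwiseCompatible X' × length X' ≡ k × All (λ f → f ∈ X ⊎ InC E M X f) X'

Replace5by6Fails : ∀ {m} → List (Edge m) → List (Edge m) → Set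
Replace5by6Fails E M =
  (length M ℕ.≤ 5 → ∀ N → IsCompatibleMatching E N → length N ≢ suc (length M))
  × (5 ℕ.< length M → ∀ X X' → Is5Subset M X → ¬ IsReplacement E M X 6 X')

Reduce5by5Fails : ∀ {m} → List (Edge m) → List (Edge m) → Set
Reduce5by5Fails E M =
  (length M ℕ.≤ 5 → ∀ N → IsCompatibleMatching E N → length N ≡ length M
     → ¬ (length (singletons N) ℕ.< length (singletons M)))
  × (5 ℕ.< length M → ∀ X X' → Is5Subset M X → IsReplacement E M X 5 X'
     → ¬ (length (singletons (minus M X ++ X')) ℕ.< length (singletons M)))

-- M is an output of LS: it is a maximal compatible matching (after step (1))
-- on which both steps (2) and (3) fail.
IsLSOutput : ∀ {m} → List (Edge m) → List (Edge m) → Set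
IsLSOutput E M = IsMaximalCM E M × Replace5by6Fails E M × Reduce5by5Fails E M

-- 1 / k as a rational (k = 0 never occurs for the relevant sets; set to 0)
inv : ℕ → ℚ
inv zero    = 0ℚ
inv (suc k) = (+ 1) ℚ./ (suc k)

Cset : ∀ {m} → List (Edge m) → Edge m → List (Edge m)
Cset M e* = filter (ConflictingSelf? e*) M

C*set : ∀ {m} → List (Edge m) → Edge m → List (Edge m)
C*set M* e = filter (λ e* → ConflictingSelf? e* e) M*

sumℚ : List ℚ → ℚ
sumℚ []       = 0ℚ
sumℚ (x ∷ xs) = x ℚ.+ sumℚ xs

ω : ∀ {m} → List (Edge m) → List (Edge m) → Edge m → ℚ
ω M M* e = sumℚ (map (λ e* → inv (length (Cset M e*))) (C*set M* e))

module Submission where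

-- Weights are measured in twelfths: 1/k ≤ u(k)/12 with u = 12, 6, 4, 3 for k = 1, 2, 3,
-- ≥ 4, so it suffices that Σ u(|C(t)|) over t ∈ C*(e) is at most 35.  If e ∈ M* then
-- C*(e) = {e}.  Otherwise every t ∈ C*(e) conflicts with e and is either near (it shares
-- an endpoint with e or e', so it conflicts with e' too) or far (it sits beside e on the
-- side away from e'); as M* is a compatible matching, at most one of its edges occupies
-- each of the four near and two far positions.  The failure of Replace-5-by-6 gives an
-- exchange principle: no |K| + 1 edges of M*, |K| ≤ 5, have all their M-conflicts in K.
-- It bounds the numbers of heavy edges (far with |C| = 1, near with |C| = 2); an
-- arithmetic lemma then gives the bound 35 except in one profile, which the exchange
-- principle also excludes, using that every conflict of the middle one of three
-- consecutive parallel edges of M* is a conflict of one of the outer two.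

open import Defs
open import Data.Empty using (⊥; ⊥-elim)
open import Data.Fin using (toℕ)
import Data.Fin.Properties as FinP
open import Data.Integer as ℤ using (+_)
import Data.Integer.Properties as ℤP
open import Data.List using (List; []; _∷_; length; filter; _++_; map; take)
open import Data.List.Properties using (length-++; length-filter)
open import Data.List.Membership.DecPropositional using () renaming (_∈?_ to member?)
open import Data.List.Membership.Propositional using (find; lose)
open import Data.List.Membership.Propositional.Properties using (∈-filter⁺; ∈-filter⁻; ∈-++⁺ˡ; ∈-++⁺ʳ; ∈-++⁻)
open import Data.List.Relation.Unary.All as All using (All; []; _∷_)
import Data.List.Relation.Unary.All.Properties as AllP
open import Data.List.Relation.Unary.AllPairs using (AllPairs; []; _∷_)
open import Data.List.Relation.Unary.Any using (Any; here; there)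
open import Data.List.Relation.Unary.Unique.Propositional using (Unique)
import Data.List.Relation.Unary.Unique.Propositional.Properties as Unique
open import Data.Nat as ℕ using (ℕ; zero; suc; _+_; _*_; _≤_; z≤n; s≤s; _∸_)
import Data.Nat.Properties as ℕP
open import Algebra.Properties.CommutativeSemigroup ℕP.+-commutativeSemigroup using (x∙yz≈y∙xz)
open import Data.Nat.ListAction using (sum)
open import Data.Product using (Σ; _×_; _,_; ∃-syntax; proj₁; proj₂)
open import Data.Rational using (_<_; ℚ; fromℚᵘ)
import Data.Rational as Q
import Data.Rational.Properties as ℚP
open import Data.Rational.Unnormalised as ℚᵘ using (mkℚᵘ; *≡*; *≤*; *<*)
import Data.Rational.Unnormalised.Properties as ℚᵘP
open import Data.Sum using (_⊎_; inj₁; inj₂; [_,_]′; swap)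
open import Function using (_∘_)
open import Relation.Binary.PropositionalEquality using (_≡_; _≢_; refl; sym; trans; cong; cong₂; subst)
open import Relation.Nullary using (¬_; Dec; yes; no)
open import Relation.Nullary.Decidable using (_×-dec_; _⊎-dec_; ¬?; toSum)
open import Relation.Unary using (Decidable)

module _ {A : Set} where

  length-split : {P : A → Set} (P? : Decidable P) (xs : List A) →
    length xs ≡ length (filter P? xs) + length (filter (¬? ∘ P?) xs)
  length-split P? [] = refl
  length-split P? (x ∷ xs) with P? x
  ... | yes _ = cong suc (length-split P? xs)
  ... | no _  = trans (cong suc (length-split P? xs)) (sym (ℕP.+-suc _ _))

  sum-split : {P : A → Set} (P? : Decidable P) (f : A → ℕ) (xs : List A) →
    sum (map f xs) ≡ sum (map f (filter P? xs)) + sum (map f (filter (¬? ∘ P?) xs))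
  sum-split P? f [] = refl
  sum-split P? f (x ∷ xs) with P? x
  ... | yes _ = trans (cong (_+_ (f x)) (sum-split P? f xs)) (sym (ℕP.+-assoc (f x) _ _))
  ... | no _  = trans (cong (_+_ (f x)) (sum-split P? f xs)) (x∙yz≈y∙xz (f x) (sum (map f (filter P? xs))) _)

  length-split₃ : {P Q : A → Set} (P? : Decidable P) (Q? : Decidable Q) (xs : List A) →
    let rest = filter (¬? ∘ P?) xs in
    length xs ≡ length (filter P? xs) + (length (filter Q? rest) + length (filter (¬? ∘ Q?) rest))
  length-split₃ P? Q? xs = trans (length-split P? xs) (cong (_+_ (length (filter P? xs))) (length-split Q? (filter (¬? ∘ P?) xs)))

  sum-split₃ : {P Q : A → Set} (P? : Decidable P) (Q? : Decidable Q) (f : A → ℕ) (xs : List A) →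
    let rest = filter (¬? ∘ P?) xs in
    sum (map f xs) ≡ sum (map f (filter P? xs)) + (sum (map f (filter Q? rest)) + sum (map f (filter (¬? ∘ Q?) rest)))
  sum-split₃ P? Q? f xs = trans (sum-split P? f xs) (cong (_+_ (sum (map f (filter P? xs)))) (sum-split Q? f (filter (¬? ∘ P?) xs)))

  sum-≤ : (f : A → ℕ) (k : ℕ) (xs : List A) → (∀ {x} → x ∈ xs → f x ≤ k) →
    sum (map f xs) ≤ k * length xs
  sum-≤ f k [] _ = z≤n
  sum-≤ f k (x ∷ xs) h =
    ℕP.≤-trans (ℕP.+-mono-≤ (h (here refl)) (sum-≤ f k xs (h ∘ there)))
               (ℕP.≤-reflexive (sym (ℕP.*-suc k (length xs))))

  filter-⊆ : {P : A → Set} (P? : Decidable P) (xs : List A) {x : A} → x ∈ filter P? xs → x ∈ xs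
  filter-⊆ P? xs p = proj₁ (∈-filter⁻ P? {xs = xs} p)

  filter-sat : {P : A → Set} (P? : Decidable P) (xs : List A) {x : A} → x ∈ filter P? xs → P x
  filter-sat P? xs p = proj₂ (∈-filter⁻ P? {xs = xs} p)

  all-equal⇒length≤1 : (xs : List A) → Unique xs → (∀ {x y} → x ∈ xs → y ∈ xs → x ≡ y) →
    length xs ≤ 1
  all-equal⇒length≤1 [] _ _ = z≤n
  all-equal⇒length≤1 (x ∷ []) _ _ = s≤s z≤n
  all-equal⇒length≤1 (x ∷ y ∷ xs) ((x≢y ∷ _) ∷ _) h = ⊥-elim (x≢y (h (here refl) (there (here refl))))

  length≤0⇒∉ : (xs : List A) → length xs ≤ 0 → ∀ {x} → x ∉ xs
  length≤0⇒∉ [] _ ()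

  pick : List A → A → A
  pick [] d = d
  pick (x ∷ _) _ = x

  pick-∈ : (xs L : List A) {d : A} → d ∈ L → (∀ {z} → z ∈ xs → z ∈ L) → pick xs d ∈ L
  pick-∈ [] L d∈L _ = d∈L
  pick-∈ (x ∷ xs) L _ xs⊆L = xs⊆L (here refl)

  length≤1⇒pick : (xs : List A) {d : A} → length xs ≤ 1 → ∀ {z} → z ∈ xs → z ≡ pick xs d
  length≤1⇒pick (x ∷ []) _ (here refl) = refl
  length≤1⇒pick (x ∷ y ∷ xs) (s≤s ())

  nonempty : (xs : List A) → 1 ≤ length xs → ∃[ x ] x ∈ xs
  nonempty (x ∷ xs) _ = x , here refl

  ∈-take : (n : ℕ) (xs : List A) {x : A} → x ∈ take n xs → x ∈ xs
  ∈-take (suc n) (y ∷ xs) (here p) = here p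
  ∈-take (suc n) (y ∷ xs) (there p) = there (∈-take n xs p)

  length-take≤ : (n : ℕ) (xs : List A) → n ≤ length xs → length (take n xs) ≡ n
  length-take≤ zero xs _ = refl
  length-take≤ (suc n) (x ∷ xs) (s≤s h) = cong suc (length-take≤ n xs h)

module _ {A : Set} (_≟_ : (x y : A) → Dec (x ≡ y)) where

  private
    remove : A → List A → List A
    remove x = filter (λ y → ¬? (x ≟ y))

    length-remove : (x : A) (S : List A) → x ∈ S → suc (length (remove x S)) ≤ length S
    length-remove x (y ∷ S) (here refl) with x ≟ x
    ... | yes _ = s≤s (length-filter (λ y → ¬? (x ≟ y)) S)
    ... | no x≢x = ⊥-elim (x≢x refl)
    length-remove x (y ∷ S) (there p) with x ≟ y
    ... | yes _ = ℕP.≤-trans (length-remove x S p) (ℕP.n≤1+n _)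
    ... | no _  = s≤s (length-remove x S p)

  unique-⊆⇒length≤ : (xs S : List A) → Unique xs → All (_∈ S) xs → length xs ≤ length S
  unique-⊆⇒length≤ [] S _ _ = z≤n
  unique-⊆⇒length≤ (x ∷ xs) S (x∉xs ∷ u) (x∈S ∷ sub) =
    ℕP.≤-trans (s≤s (unique-⊆⇒length≤ xs (remove x S) u
                  (All.zipWith (λ (y∈S , x≢y) → ∈-filter⁺ (λ y → ¬? (x ≟ y)) y∈S x≢y) (sub , x∉xs))))
               (length-remove x S x∈S)

  outside : (X : List A) → List A → List A
  outside X = filter (λ z → ¬? (member? _≟_ z X))

  outside⁺ : (X L : List A) {z : A} → z ∈ L → z ∉ X → z ∈ outside X L
  outside⁺ X L z∈L z∉X = ∈-filter⁺ (λ z → ¬? (member? _≟_ z X)) z∈L z∉X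

  outside-length : (X L : List A) (k : ℕ) → Unique X → All (_∈ L) X → length L ≤ length X + k →
    length (outside X L) ≤ k
  outside-length X L k uX X⊆L L≤ =
    ℕP.+-cancelˡ-≤ (length X) _ k (ℕP.≤-trans (ℕP.+-monoˡ-≤ _ inside)
      (ℕP.≤-trans (ℕP.≤-reflexive (sym (length-split (λ z → member? _≟_ z X) L))) L≤))
    where
    inside : length X ≤ length (filter (λ z → member? _≟_ z X) L)
    inside = unique-⊆⇒length≤ X _ uX (All.tabulate (λ {x} x∈X → ∈-filter⁺ (λ z → member? _≟_ z X) (All.lookup X⊆L x∈X) x∈X))

  squeezed : (X L : List A) → Unique X → All (_∈ L) X → length L ≤ length X →
    ∀ {z} → z ∈ L → z ∈ X
  squeezed X L uX X⊆L L≤ {z} z∈L with member? _≟_ z X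
  ... | yes z∈X = z∈X
  ... | no z∉X = ⊥-elim (length≤0⇒∉ (outside X L) none (outside⁺ X L z∈L z∉X))
    where
    none : length (outside X L) ≤ 0
    none = outside-length X L 0 uX X⊆L (ℕP.≤-trans L≤ (ℕP.≤-reflexive (sym (ℕP.+-identityʳ _))))

  one-more : (X L : List A) {d : A} → d ∈ L → Unique X → All (_∈ L) X → length L ≤ suc (length X) →
    ∃[ g ] (g ∈ L × (∀ {z} → z ∈ L → z ∈ X ⊎ z ≡ g))
  one-more X L {d} d∈L uX X⊆L L≤ = g , pick-∈ O L d∈L (filter-⊆ _ L) , classify
    where
    O = outside X L
    g = pick O d
    O≤1 : length O ≤ 1
    O≤1 = outside-length X L 1 uX X⊆L (ℕP.≤-trans L≤ (ℕP.≤-reflexive (ℕP.+-comm 1 _)))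
    classify : ∀ {z} → z ∈ L → z ∈ X ⊎ z ≡ g
    classify {z} z∈L with member? _≟_ z X
    ... | yes z∈X = inj₁ z∈X
    ... | no z∉X = inj₂ (length≤1⇒pick O O≤1 (outside⁺ X L z∈L z∉X))

module Covering {A : Set} (D : A → Set) where

  Class : Set₁
  Class = Σ (A → Set) Decidable

  Singular : Class → Set
  Singular (P , _) = ∀ {x y} → D x → D y → P x → P y → x ≡ y

  InSome : List Class → A → Set₁
  InSome Ps x = Any (λ P → proj₁ P x) Ps

  private
    rest : Class → List A → List A
    rest (_ , P?) = filter (¬? ∘ P?)

    rest-covered : (P : Class) (Ps : List Class) (L : List A) → All (InSome (P ∷ Ps)) L →
      All (InSome Ps) (rest P L)
    rest-covered (P , P?) Ps L cov = All.tabulate λ {x} x∈ → drop-first (filter-sat (¬? ∘ P?) L x∈)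
                                                          (All.lookup cov (filter-⊆ (¬? ∘ P?) L x∈))
      where
      drop-first : ∀ {x} → ¬ P x → InSome ((P , P?) ∷ Ps) x → InSome Ps x
      drop-first ¬Px (here Px) = ⊥-elim (¬Px Px)
      drop-first _ (there in-Ps) = in-Ps

    first≤1 : (P : Class) (L : List A) → Unique L → All D L → Singular P →
      length (filter (proj₂ P) L) ≤ 1
    first≤1 (P , P?) L uL DL sP = all-equal⇒length≤1 _ (Unique.filter⁺ P? uL) λ x∈ y∈ →
      sP (All.lookup DL (filter-⊆ P? L x∈)) (All.lookup DL (filter-⊆ P? L y∈))
         (filter-sat P? L x∈) (filter-sat P? L y∈)

    rest-in-D : (P : Class) (L : List A) → All D L → All D (rest P L)
    rest-in-D (_ , P?) L DL = AllP.filter⁺ (¬? ∘ P?) DL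

    tight-split : ∀ {a b n} → a ≤ 1 → b ≤ n → suc n ≤ a + b → 1 ≤ a × n ≤ b
    tight-split z≤n b≤n h = ⊥-elim (ℕP.1+n≰n (ℕP.≤-trans h b≤n))
    tight-split (s≤s z≤n) _ (s≤s h) = s≤s z≤n , h

  covered-length : (Ps : List Class) (L : List A) → Unique L → All D L → All Singular Ps →
    All (InSome Ps) L → length L ≤ length Ps
  covered-length [] [] _ _ _ _ = z≤n
  covered-length [] (x ∷ L) _ _ _ (() ∷ _)
  covered-length (P ∷ Ps) L uL DL (sP ∷ sPs) cov =
    ℕP.≤-trans (ℕP.≤-reflexive (length-split (proj₂ P) L))
      (ℕP.+-mono-≤ (first≤1 P L uL DL sP)
        (covered-length Ps (rest P L) (Unique.filter⁺ _ uL) (rest-in-D P L DL) sPs (rest-covered P Ps L cov)))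

  covered-witnesses : (Ps : List Class) (L : List A) → Unique L → All D L → All Singular Ps →
    All (InSome Ps) L → length Ps ≤ length L → All (λ P → ∃[ x ] (x ∈ L × proj₁ P x)) Ps
  covered-witnesses [] L _ _ _ _ _ = []
  covered-witnesses (P ∷ Ps) L uL DL (sP ∷ sPs) cov Ps≤L =
    first-witness ∷ All.map (λ (x , x∈ , Px) → x , filter-⊆ _ L x∈ , Px)
                            (covered-witnesses Ps (rest P L) uR DR sPs covR rest≥)
    where
    uR = Unique.filter⁺ _ uL
    DR = rest-in-D P L DL
    covR = rest-covered P Ps L cov
    tight : 1 ≤ length (filter (proj₂ P) L) × length Ps ≤ length (rest P L)
    tight = tight-split (first≤1 P L uL DL sP) (covered-length Ps (rest P L) uR DR sPs covR)
              (ℕP.≤-trans Ps≤L (ℕP.≤-reflexive (length-split (proj₂ P) L)))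
    rest≥ = proj₂ tight
    first-witness : ∃[ x ] (x ∈ L × proj₁ P x)
    first-witness with nonempty _ (proj₁ tight)
    ... | x , x∈ = x , filter-⊆ (proj₂ P) L x∈ , filter-sat (proj₂ P) L x∈


module _ {m : ℕ} where

  vA vB : Edge m → ℕ
  vA e = toℕ (proj₁ e)
  vB e = toℕ (proj₂ e)

  edge-ext : {e f : Edge m} → vA e ≡ vA f → vB e ≡ vB f → e ≡ f
  edge-ext {i , j} {i' , j'} p q = cong₂ _,_ (FinP.toℕ-injective p) (FinP.toℕ-injective q)

  n≢1+n : ∀ {n} → n ≢ suc n
  n≢1+n ()

  n≢2+n : ∀ {n} → n ≢ suc (suc n)
  n≢2+n ()

  vA≢ : {e f : Edge m} → vA e ≢ vA f → e ≢ f
  vA≢ ne refl = ne refl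

  vB≢ : {e f : Edge m} → vB e ≢ vB f → e ≢ f
  vB≢ ne refl = ne refl

  conflict-sym : {e f : Edge m} → Conflicting e f → Conflicting f e
  conflict-sym {i , j} {i' , j'} (ne , core) = (λ eq → ne (sym eq)) , flip core
    where
    flip : ConflictCore (i , j) (i' , j') → ConflictCore (i' , j') (i , j)
    flip (inj₁ (inj₁ p)) = inj₁ (inj₁ (sym p))
    flip (inj₁ (inj₂ p)) = inj₁ (inj₂ (sym p))
    flip (inj₂ (inj₁ p)) = inj₂ (inj₂ (inj₁ p))
    flip (inj₂ (inj₂ (inj₁ p))) = inj₂ (inj₁ p)
    flip (inj₂ (inj₂ (inj₂ (inj₁ p)))) = inj₂ (inj₂ (inj₂ (inj₂ p)))
    flip (inj₂ (inj₂ (inj₂ (inj₂ p)))) = inj₂ (inj₂ (inj₂ (inj₁ p)))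

  share-A : {e f : Edge m} → vA e ≡ vA f → e ≢ f → Conflicting e f
  share-A {i , j} {i' , j'} p ne = ne , inj₁ (inj₁ (FinP.toℕ-injective p))

  share-B : {e f : Edge m} → vB e ≡ vB f → e ≢ f → Conflicting e f
  share-B {i , j} {i' , j'} p ne = ne , inj₁ (inj₂ (FinP.toℕ-injective p))

  members-compatible : {L : List (Edge m)} → PairwiseCompatible L →
    ∀ {x y} → x ∈ L → y ∈ L → Compatible x y
  members-compatible (_ , ap) = go ap
    where
    go : ∀ {L} → AllPairs Compatible L → ∀ {x y} → x ∈ L → y ∈ L → Compatible x y
    go (_ ∷ _) (here refl) (here refl) (ne , _) = ne refl
    go (h ∷ _) (here refl) (there q) c = All.lookup h q c
    go (h ∷ _) (there p) (here refl) c = All.lookup h p (conflict-sym c)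
    go (_ ∷ a) (there p) (there q) c = go a p q c

  same-A : {L : List (Edge m)} → PairwiseCompatible L → ∀ {s t} → s ∈ L → t ∈ L → vA s ≡ vA t → s ≡ t
  same-A pc {s} {t} s∈ t∈ eq with s ≟E t
  ... | yes s≡t = s≡t
  ... | no s≢t = ⊥-elim (members-compatible pc s∈ t∈ (share-A eq s≢t))

  same-B : {L : List (Edge m)} → PairwiseCompatible L → ∀ {s t} → s ∈ L → t ∈ L → vB s ≡ vB t → s ≡ t
  same-B pc {s} {t} s∈ t∈ eq with s ≟E t
  ... | yes s≡t = s≡t
  ... | no s≢t = ⊥-elim (members-compatible pc s∈ t∈ (share-B eq s≢t))

  parallel⇒distinct : {e f : Edge m} → Parallel e f → e ≢ f
  parallel⇒distinct (inj₁ (a , _)) refl = n≢1+n a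
  parallel⇒distinct (inj₂ (a , _)) refl = n≢1+n a

  parallel⇒compatible : {e f : Edge m} → Parallel e f → Compatible e f
  parallel⇒compatible {i , j} {i' , j'} (inj₁ (a , b)) (_ , core) = go core
    where
    go : ¬ ConflictCore (i , j) (i' , j')
    go (inj₁ (inj₁ p)) = n≢1+n (trans (cong toℕ p) a)
    go (inj₁ (inj₂ p)) = n≢1+n (trans (cong toℕ p) b)
    go (inj₂ (inj₁ (_ , q))) = q b
    go (inj₂ (inj₂ (inj₁ (p , _)))) = n≢2+n (trans p (cong suc a))
    go (inj₂ (inj₂ (inj₂ (inj₁ (_ , q))))) = q a
    go (inj₂ (inj₂ (inj₂ (inj₂ (p , _))))) = n≢2+n (trans p (cong suc b))
  parallel⇒compatible {i , j} {i' , j'} (inj₂ (a , b)) (_ , core) = go core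
    where
    go : ¬ ConflictCore (i , j) (i' , j')
    go (inj₁ (inj₁ p)) = n≢1+n (trans (cong toℕ (sym p)) a)
    go (inj₁ (inj₂ p)) = n≢1+n (trans (cong toℕ (sym p)) b)
    go (inj₂ (inj₁ (p , _))) = n≢2+n (trans p (cong suc a))
    go (inj₂ (inj₂ (inj₁ (_ , q)))) = q b
    go (inj₂ (inj₂ (inj₂ (inj₁ (p , _))))) = n≢2+n (trans p (cong suc b))
    go (inj₂ (inj₂ (inj₂ (inj₂ (_ , q))))) = q a

  consecutive-A : {p q : Edge m} → Compatible p q → vA q ≡ suc (vA p) → vB q ≡ suc (vB p)
  consecutive-A {i , j} {i' , j'} c s with vB (i' , j') ℕP.≟ suc (vB (i , j))
  ... | yes r = r
  ... | no r = ⊥-elim (c (vA≢ (λ eq → n≢1+n (trans eq s)) , inj₂ (inj₁ (s , r))))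

  consecutive-B : {p q : Edge m} → Compatible p q → vB q ≡ suc (vB p) → vA q ≡ suc (vA p)
  consecutive-B {i , j} {i' , j'} c s with vA (i' , j') ℕP.≟ suc (vA (i , j))
  ... | yes r = r
  ... | no r = ⊥-elim (c (vB≢ (λ eq → n≢1+n (trans eq s)) , inj₂ (inj₂ (inj₂ (inj₁ (s , r))))))

  middle-conflict : (p q r f : Edge m) → vA q ≡ suc (vA p) → vB q ≡ suc (vB p) →
    vA r ≡ suc (vA q) → vB r ≡ suc (vB q) → Conflicting f q → Conflicting f p ⊎ Conflicting f r
  middle-conflict (a , b) (c , d) (g , h) (x , y) aq bq ar br (ne , inj₁ (inj₁ refl)) =
    inj₁ (vA≢ (λ eq → n≢1+n (trans (sym eq) aq)) ,
          inj₂ (inj₂ (inj₁ (aq , λ s → ne (edge-ext refl (trans s (sym bq)))))))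
  middle-conflict (a , b) (c , d) (g , h) (x , y) aq bq ar br (ne , inj₁ (inj₂ refl)) =
    inj₁ (vB≢ (λ eq → n≢1+n (trans (sym eq) bq)) ,
          inj₂ (inj₂ (inj₂ (inj₂ (bq , λ s → ne (edge-ext (trans s (sym aq)) refl))))))
  middle-conflict (a , b) (c , d) (g , h) (x , y) aq bq ar br (ne , inj₂ (inj₁ (s , t))) =
    inj₁ (share-A (ℕP.suc-injective (trans (sym s) aq)) (λ eq → t (trans bq (cong (λ z → suc (vB z)) (sym eq)))))
  middle-conflict (a , b) (c , d) (g , h) (x , y) aq bq ar br (ne , inj₂ (inj₂ (inj₁ (s , t)))) =
    inj₂ (share-A (trans s (sym ar)) (λ eq → t (trans (cong vB eq) br)))
  middle-conflict (a , b) (c , d) (g , h) (x , y) aq bq ar br (ne , inj₂ (inj₂ (inj₂ (inj₁ (s , t))))) =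
    inj₁ (share-B (ℕP.suc-injective (trans (sym s) bq)) (λ eq → t (trans aq (cong (λ z → suc (vA z)) (sym eq)))))
  middle-conflict (a , b) (c , d) (g , h) (x , y) aq bq ar br (ne , inj₂ (inj₂ (inj₂ (inj₂ (s , t))))) =
    inj₂ (share-B (trans s (sym br)) (λ eq → t (trans (cong vA eq) ar)))

  Near : (e e' t : Edge m) → Set
  Near e e' t = vA t ≡ vA e ⊎ vA t ≡ vA e' ⊎ vB t ≡ vB e ⊎ vB t ≡ vB e'

  Near? : (e e' t : Edge m) → Dec (Near e e' t)
  Near? e e' t = (vA t ℕP.≟ vA e) ⊎-dec (vA t ℕP.≟ vA e') ⊎-dec (vB t ℕP.≟ vB e) ⊎-dec (vB t ℕP.≟ vB e')

  FarA : (e e' t : Edge m) → Set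
  FarA e e' t = (suc (vA t) ≡ vA e ⊎ vA t ≡ suc (vA e)) × vA t ≢ vA e'

  FarA? : (e e' t : Edge m) → Dec (FarA e e' t)
  FarA? e e' t = ((suc (vA t) ℕP.≟ vA e) ⊎-dec (vA t ℕP.≟ suc (vA e))) ×-dec ¬? (vA t ℕP.≟ vA e')

  FarB : (e e' t : Edge m) → Set
  FarB e e' t = (suc (vB t) ≡ vB e ⊎ vB t ≡ suc (vB e)) × vB t ≢ vB e'

  FarB? : (e e' t : Edge m) → Dec (FarB e e' t)
  FarB? e e' t = ((suc (vB t) ℕP.≟ vB e) ⊎-dec (vB t ℕP.≟ suc (vB e))) ×-dec ¬? (vB t ℕP.≟ vB e')

  near-or-far : (e e' t : Edge m) → Conflicting t e → ¬ Near e e' t → FarA e e' t ⊎ FarB e e' t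
  near-or-far e e' t (_ , inj₁ (inj₁ p)) ¬near = ⊥-elim (¬near (inj₁ (cong toℕ p)))
  near-or-far e e' t (_ , inj₁ (inj₂ p)) ¬near = ⊥-elim (¬near (inj₂ (inj₂ (inj₁ (cong toℕ p)))))
  near-or-far e e' t (_ , inj₂ (inj₁ (s , _))) ¬near =
    inj₁ (inj₁ (sym s) , λ q → ¬near (inj₂ (inj₁ q)))
  near-or-far e e' t (_ , inj₂ (inj₂ (inj₁ (s , _)))) ¬near =
    inj₁ (inj₂ s , λ q → ¬near (inj₂ (inj₁ q)))
  near-or-far e e' t (_ , inj₂ (inj₂ (inj₂ (inj₁ (s , _))))) ¬near =
    inj₂ (inj₁ (sym s) , λ q → ¬near (inj₂ (inj₂ (inj₂ q))))
  near-or-far e e' t (_ , inj₂ (inj₂ (inj₂ (inj₂ (s , _))))) ¬near =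
    inj₂ (inj₂ s , λ q → ¬near (inj₂ (inj₂ (inj₂ q))))

  near⇒conflicts' : (e e' t : Edge m) → Parallel e e' → Conflicting t e → Near e e' t →
    Conflicting t e'
  near⇒conflicts' (i , j) (i' , j') (x , y) (inj₁ (a , b)) (ne , _) (inj₁ nx) =
    vA≢ {e = x , y} {f = i' , j'} (λ eq → n≢1+n (trans (trans (sym nx) eq) a)) ,
    inj₂ (inj₁ (trans a (cong suc (sym nx)) ,
                λ q → ne (edge-ext nx (ℕP.suc-injective (trans (sym q) b)))))
  near⇒conflicts' (i , j) (i' , j') (x , y) (inj₂ (a , b)) (ne , _) (inj₁ nx) =
    vA≢ {e = x , y} {f = i' , j'} (λ eq → n≢1+n (trans (sym eq) (trans nx a))) ,
    inj₂ (inj₂ (inj₁ (trans nx a , λ q → ne (edge-ext nx (trans q (sym b))))))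
  near⇒conflicts' e e' t par c (inj₂ (inj₁ nx)) =
    share-A nx (λ t≡e' → parallel⇒compatible par (conflict-sym (subst (λ z → Conflicting z e) t≡e' c)))
  near⇒conflicts' (i , j) (i' , j') (x , y) (inj₁ (a , b)) (ne , _) (inj₂ (inj₂ (inj₁ ny))) =
    vB≢ {e = x , y} {f = i' , j'} (λ eq → n≢1+n (trans (trans (sym ny) eq) b)) ,
    inj₂ (inj₂ (inj₂ (inj₁ (trans b (cong suc (sym ny)) ,
                            λ q → ne (edge-ext (ℕP.suc-injective (trans (sym q) a)) ny)))))
  near⇒conflicts' (i , j) (i' , j') (x , y) (inj₂ (a , b)) (ne , _) (inj₂ (inj₂ (inj₁ ny))) =
    vB≢ {e = x , y} {f = i' , j'} (λ eq → n≢1+n (trans (sym eq) (trans ny b))) ,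
    inj₂ (inj₂ (inj₂ (inj₂ (trans ny b , λ q → ne (edge-ext (trans q (sym a)) ny)))))
  near⇒conflicts' e e' t par c (inj₂ (inj₂ (inj₂ ny))) =
    share-B ny (λ t≡e' → parallel⇒compatible par (conflict-sym (subst (λ z → Conflicting z e) t≡e' c)))

  farA-index : (e e' s t : Edge m) → Parallel e e' → FarA e e' s → FarA e e' t → vA s ≡ vA t
  farA-index (i , j) (i' , j') s t (inj₁ (a , _)) (inj₁ p , _) (inj₁ q , _) = ℕP.suc-injective (trans p (sym q))
  farA-index (i , j) (i' , j') s t (inj₁ (a , _)) (inj₁ p , _) (inj₂ q , nq) = ⊥-elim (nq (trans q (sym a)))
  farA-index (i , j) (i' , j') s t (inj₁ (a , _)) (inj₂ p , np) _ = ⊥-elim (np (trans p (sym a)))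
  farA-index (i , j) (i' , j') s t (inj₂ (a , _)) (inj₂ p , _) (inj₂ q , _) = trans p (sym q)
  farA-index (i , j) (i' , j') s t (inj₂ (a , _)) (inj₂ p , _) (inj₁ q , nq) = ⊥-elim (nq (ℕP.suc-injective (trans q a)))
  farA-index (i , j) (i' , j') s t (inj₂ (a , _)) (inj₁ p , np) _ = ⊥-elim (np (ℕP.suc-injective (trans p a)))

  farB-index : (e e' s t : Edge m) → Parallel e e' → FarB e e' s → FarB e e' t → vB s ≡ vB t
  farB-index (i , j) (i' , j') s t (inj₁ (_ , b)) (inj₁ p , _) (inj₁ q , _) = ℕP.suc-injective (trans p (sym q))
  farB-index (i , j) (i' , j') s t (inj₁ (_ , b)) (inj₁ p , _) (inj₂ q , nq) = ⊥-elim (nq (trans q (sym b)))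
  farB-index (i , j) (i' , j') s t (inj₁ (_ , b)) (inj₂ p , np) _ = ⊥-elim (np (trans p (sym b)))
  farB-index (i , j) (i' , j') s t (inj₂ (_ , b)) (inj₂ p , _) (inj₂ q , _) = trans p (sym q)
  farB-index (i , j) (i' , j') s t (inj₂ (_ , b)) (inj₂ p , _) (inj₁ q , nq) = ⊥-elim (nq (ℕP.suc-injective (trans q b)))
  farB-index (i , j) (i' , j') s t (inj₂ (_ , b)) (inj₁ p , np) _ = ⊥-elim (np (ℕP.suc-injective (trans p b)))

  -- In a compatible set, an A-far edge p, an edge a₀ at the D^A-index of e and an edge a₁
  -- at the D^A-index of e' are three consecutive parallel edges, so every conflict of a₀
  -- is a conflict of p or of a₁; likewise for the D^B side.
  far-chain-A : {L : List (Edge m)} → PairwiseCompatible L → (e e' : Edge m) → Parallel e e' →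
    {p a₀ a₁ : Edge m} → p ∈ L → a₀ ∈ L → a₁ ∈ L → FarA e e' p → vA a₀ ≡ vA e → vA a₁ ≡ vA e' →
    ∀ f → Conflicting f a₀ → Conflicting f p ⊎ Conflicting f a₁
  far-chain-A pc e e' (inj₁ (s , _)) {p} {a₀} {a₁} p∈ a₀∈ a₁∈ (side , p≢) h₀ h₁ f c =
    middle-conflict p a₀ a₁ f pa₀ (consecutive-A (members-compatible pc p∈ a₀∈) pa₀)
                             a₀a₁ (consecutive-A (members-compatible pc a₀∈ a₁∈) a₀a₁) c
    where
    below : suc (vA p) ≡ vA e
    below = [ (λ q → q) , (λ q → ⊥-elim (p≢ (trans q (sym s)))) ]′ side
    pa₀ = trans h₀ (sym below)
    a₀a₁ = trans h₁ (trans s (cong suc (sym h₀)))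
  far-chain-A pc e e' (inj₂ (s , _)) {p} {a₀} {a₁} p∈ a₀∈ a₁∈ (side , p≢) h₀ h₁ f c =
    swap (middle-conflict a₁ a₀ p f a₁a₀ (consecutive-A (members-compatible pc a₁∈ a₀∈) a₁a₀)
                                  a₀p (consecutive-A (members-compatible pc a₀∈ p∈) a₀p) c)
    where
    above : vA p ≡ suc (vA e)
    above = [ (λ q → ⊥-elim (p≢ (ℕP.suc-injective (trans q s)))) , (λ q → q) ]′ side
    a₁a₀ = trans h₀ (trans s (cong suc (sym h₁)))
    a₀p = trans above (cong suc (sym h₀))

  far-chain-B : {L : List (Edge m)} → PairwiseCompatible L → (e e' : Edge m) → Parallel e e' →
    {p b₀ b₁ : Edge m} → p ∈ L → b₀ ∈ L → b₁ ∈ L → FarB e e' p → vB b₀ ≡ vB e → vB b₁ ≡ vB e' →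
    ∀ f → Conflicting f b₀ → Conflicting f p ⊎ Conflicting f b₁
  far-chain-B pc e e' (inj₁ (_ , s)) {p} {b₀} {b₁} p∈ b₀∈ b₁∈ (side , p≢) h₀ h₁ f c =
    middle-conflict p b₀ b₁ f (consecutive-B (members-compatible pc p∈ b₀∈) pb₀) pb₀
                              (consecutive-B (members-compatible pc b₀∈ b₁∈) b₀b₁) b₀b₁ c
    where
    below : suc (vB p) ≡ vB e
    below = [ (λ q → q) , (λ q → ⊥-elim (p≢ (trans q (sym s)))) ]′ side
    pb₀ = trans h₀ (sym below)
    b₀b₁ = trans h₁ (trans s (cong suc (sym h₀)))
  far-chain-B pc e e' (inj₂ (_ , s)) {p} {b₀} {b₁} p∈ b₀∈ b₁∈ (side , p≢) h₀ h₁ f c =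
    swap (middle-conflict b₁ b₀ p f (consecutive-B (members-compatible pc b₁∈ b₀∈) b₁b₀) b₁b₀
                                    (consecutive-B (members-compatible pc b₀∈ p∈) b₀p) b₀p c)
    where
    above : vB p ≡ suc (vB e)
    above = [ (λ q → ⊥-elim (p≢ (ℕP.suc-injective (trans q s)))) , (λ q → q) ]′ side
    b₁b₀ = trans h₀ (trans s (cong suc (sym h₁)))
    b₀p = trans above (cong suc (sym h₀))


-- The exchange principle behind Replace-5-by-6.  Let K be at most five edges and Y more
-- than |K| edges of a compatible matching M*, each conflicting with M but only with
-- edges of K.  Then removing M ∩ K from M and adding |M ∩ K| + 1 edges of Y gives a
-- larger compatible matching, obtained from M by replacing a 5-element subset with 6
-- edges (or, if |M| ≤ 5, outright) — impossible when Replace-5-by-6 fails on M.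
module Exchange {m : ℕ} (E M : List (Edge m)) (cmM : IsCompatibleMatching E M)
                (fails : Replace5by6Fails E M) (M* : List (Edge m)) (cm* : IsCompatibleMatching E M*)
                (K Y : List (Edge m)) (K≤5 : length K ≤ 5) (K<Y : length K ℕ.< length Y)
                (uY : Unique Y) (Y⊆M* : All (_∈ M*) Y)
                (Y-conflicts : ∀ {y} → y ∈ Y → Any (Conflicting y) M)
                (Y-confined : ∀ {y f} → y ∈ Y → f ∈ M → Conflicting y f → f ∈ K) where

  private
    uM = proj₁ (proj₂ cmM)
    in-K? = λ (f : Edge m) → f ∈? K
    out-K? = λ (f : Edge m) → ¬? (f ∈? K)

  K₀ R : List (Edge m)
  K₀ = filter in-K? M
  R = filter out-K? M

  k : ℕ
  k = length K₀

  k≤K : k ≤ length K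
  k≤K = unique-⊆⇒length≤ _≟E_ K₀ K (Unique.filter⁺ in-K? uM) (All.tabulate (filter-sat in-K? M))

  R+k : length R + k ≡ length M
  R+k = trans (ℕP.+-comm (length R) k) (sym (length-split in-K? M))

  Y∉M : ∀ {y} → y ∈ Y → y ∈ M → ⊥
  Y∉M y∈Y y∈M with find (Y-conflicts y∈Y)
  ... | f , f∈M , c = members-compatible (proj₂ cmM) y∈M f∈M c

  -- Edges of R ∪ Y are pairwise compatible: an edge of Y conflicts only with edges
  -- of K, and R avoids K.
  Good : Edge m → Set
  Good z = z ∈ R ⊎ z ∈ Y

  good-compatible : ∀ {x z} → Good x → Good z → Compatible x z
  good-compatible (inj₁ x∈R) (inj₁ z∈R) = members-compatible (proj₂ cmM) (filter-⊆ out-K? M x∈R) (filter-⊆ out-K? M z∈R)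
  good-compatible (inj₂ x∈Y) (inj₂ z∈Y) = members-compatible (proj₂ cm*) (All.lookup Y⊆M* x∈Y) (All.lookup Y⊆M* z∈Y)
  good-compatible (inj₂ x∈Y) (inj₁ z∈R) c = filter-sat out-K? M z∈R (Y-confined x∈Y (filter-⊆ out-K? M z∈R) c)
  good-compatible (inj₁ x∈R) (inj₂ z∈Y) c = filter-sat out-K? M x∈R (Y-confined z∈Y (filter-⊆ out-K? M x∈R) (conflict-sym c))

  good-in-E : ∀ {z} → Good z → z ∈ E
  good-in-E (inj₁ z∈R) = All.lookup (proj₁ cmM) (filter-⊆ out-K? M z∈R)
  good-in-E (inj₂ z∈Y) = All.lookup (proj₁ cm*) (All.lookup Y⊆M* z∈Y)

  good-pairwise : (L : List (Edge m)) → Unique L → (∀ {z} → z ∈ L → Good z) → PairwiseCompatible L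
  good-pairwise L uL good = uL , go L good
    where
    go : (L : List (Edge m)) → (∀ {z} → z ∈ L → Good z) → AllPairs Compatible L
    go [] _ = []
    go (x ∷ L) good = All.tabulate (λ z∈ → good-compatible (good (here refl)) (good (there z∈))) ∷ go L (good ∘ there)

  Y' : List (Edge m)
  Y' = take (suc k) Y

  |Y'| : length Y' ≡ suc k
  |Y'| = length-take≤ (suc k) Y (ℕP.≤-trans (s≤s k≤K) K<Y)

  Y'⊆Y : ∀ {y} → y ∈ Y' → y ∈ Y
  Y'⊆Y = ∈-take (suc k) Y

  uY' : Unique Y'
  uY' = Unique.take⁺ (suc k) uY

  bigger-matching : length M ≤ 5 → ⊥
  bigger-matching M≤5 = proj₁ fails M≤5 N (All.tabulate (good-in-E ∘ good) , good-pairwise N uN good) |N|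
    where
    N = R ++ Y'
    good : ∀ {z} → z ∈ N → Good z
    good z∈ = [ inj₁ , inj₂ ∘ Y'⊆Y ]′ (∈-++⁻ R z∈)
    uN : Unique N
    uN = Unique.++⁺ (Unique.filter⁺ out-K? uM) uY' (λ (r∈ , y∈) → Y∉M (Y'⊆Y y∈) (filter-⊆ out-K? M r∈))
    |N| : length N ≡ suc (length M)
    |N| = trans (length-++ R) (trans (cong (_+_ (length R)) |Y'|) (trans (ℕP.+-suc (length R) k) (cong suc R+k)))

  -- Large M: pad K₀ and Y' with the same 5 - |K₀| edges of R; this replaces a
  -- 5-element subset X of M by 6 pairwise compatible edges of X ∪ C(X).
  replacement : 5 ℕ.< length M → ⊥
  replacement 5<M = proj₂ fails 5<M X X' (uX , X⊆M , |X|) (good-pairwise X' uX' good' , |X'| , from-X∪C)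
    where
    P = take (5 ∸ k) R
    |P| : length P ≡ 5 ∸ k
    |P| = length-take≤ (5 ∸ k) R (ℕP.+-cancelʳ-≤ k (5 ∸ k) (length R)
            (ℕP.≤-trans (ℕP.≤-reflexive (ℕP.m∸n+n≡m (ℕP.≤-trans k≤K K≤5)))
              (ℕP.≤-trans (ℕP.n≤1+n 5) (ℕP.≤-trans 5<M (ℕP.≤-reflexive (sym R+k))))))
    P⊆R : ∀ {r} → r ∈ P → r ∈ R
    P⊆R = ∈-take (5 ∸ k) R
    X X' : List (Edge m)
    X = K₀ ++ P
    X' = Y' ++ P
    uX : Unique X
    uX = Unique.++⁺ (Unique.filter⁺ in-K? uM) (Unique.take⁺ (5 ∸ k) (Unique.filter⁺ out-K? uM))
           (λ (k∈ , p∈) → filter-sat out-K? M (P⊆R p∈) (filter-sat in-K? M k∈))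
    X⊆M : All (_∈ M) X
    X⊆M = All.tabulate λ z∈ → [ filter-⊆ in-K? M , filter-⊆ out-K? M ∘ P⊆R ]′ (∈-++⁻ K₀ z∈)
    |X| : length X ≡ 5
    |X| = trans (length-++ K₀) (trans (cong (_+_ k) |P|) (ℕP.m+[n∸m]≡n (ℕP.≤-trans k≤K K≤5)))
    uX' : Unique X'
    uX' = Unique.++⁺ uY' (Unique.take⁺ (5 ∸ k) (Unique.filter⁺ out-K? uM))
            (λ (y∈ , p∈) → Y∉M (Y'⊆Y y∈) (filter-⊆ out-K? M (P⊆R p∈)))
    good' : ∀ {z} → z ∈ X' → Good z
    good' z∈ = [ inj₂ ∘ Y'⊆Y , inj₁ ∘ P⊆R ]′ (∈-++⁻ Y' z∈)
    |X'| : length X' ≡ 6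
    |X'| = trans (length-++ Y') (trans (cong₂ _+_ |Y'| |P|) (cong suc (ℕP.m+[n∸m]≡n (ℕP.≤-trans k≤K K≤5))))
    confined-X : ∀ {y f} → y ∈ Y → f ∈ M → Conflicting y f → f ∈ X
    confined-X y∈ f∈M c = ∈-++⁺ˡ (∈-filter⁺ in-K? f∈M (Y-confined y∈ f∈M c))
    in-C : ∀ {y} → y ∈ Y → InC E M X y
    in-C y∈ with find (Y-conflicts y∈)
    ... | f , f∈M , c =
      All.lookup (proj₁ cm*) (All.lookup Y⊆M* y∈) ,
      lose (confined-X y∈ f∈M c) c ,
      All.tabulate λ f∈ c' → filter-sat (λ e → ¬? (e ∈? X)) M f∈
                               (confined-X y∈ (filter-⊆ (λ e → ¬? (e ∈? X)) M f∈) c')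
    from-X∪C : All (λ f → f ∈ X ⊎ InC E M X f) X'
    from-X∪C = All.tabulate λ z∈ → [ inj₂ ∘ in-C ∘ Y'⊆Y , inj₁ ∘ ∈-++⁺ʳ K₀ ]′ (∈-++⁻ Y' z∈)

  contradiction : ⊥
  contradiction with length M ℕP.≤? 5
  ... | yes M≤5 = bigger-matching M≤5
  ... | no M≰5 = replacement (ℕP.≰⇒> M≰5)


-- Weights are measured in twelfths: u k / 12 is an upper bound for 1 / k (exact for
-- k = 1, 2, 3), so sums of the weights 1/k are controlled by natural-number sums of u k.
u : ℕ → ℕ
u 0 = 0
u 1 = 12
u 2 = 6
u 3 = 4
u (suc (suc (suc (suc _)))) = 3

u≤12 : ∀ k → u k ≤ 12
u≤12 0 = z≤n
u≤12 1 = ℕP.≤-refl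
u≤12 2 = ℕP.≤ᵇ⇒≤ 6 12 _
u≤12 3 = ℕP.≤ᵇ⇒≤ 4 12 _
u≤12 (suc (suc (suc (suc _)))) = ℕP.≤ᵇ⇒≤ 3 12 _

u≤4 : ∀ k → k ≢ 1 → k ≢ 2 → u k ≤ 4
u≤4 0 _ _ = z≤n
u≤4 1 k≢1 _ = ⊥-elim (k≢1 refl)
u≤4 2 _ k≢2 = ⊥-elim (k≢2 refl)
u≤4 3 _ _ = ℕP.≤-refl
u≤4 (suc (suc (suc (suc _)))) _ _ = ℕP.n≤1+n 3

u≤3 : ∀ k → 2 ≤ k → k ≢ 2 → k ≢ 3 → u k ≤ 3
u≤3 1 (s≤s ()) _ _
u≤3 2 _ k≢2 _ = ⊥-elim (k≢2 refl)
u≤3 3 _ _ k≢3 = ⊥-elim (k≢3 refl)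
u≤3 (suc (suc (suc (suc _)))) _ _ _ = ℕP.≤-refl

twelfths : ℕ → ℚ
twelfths a = fromℚᵘ (mkℚᵘ (+ a) 11)

private
  as-ℚᵘ : ∀ a → Q.toℚᵘ (twelfths a) ℚᵘ.≃ mkℚᵘ (+ a) 11
  as-ℚᵘ a = ℚP.toℚᵘ-fromℚᵘ (mkℚᵘ (+ a) 11)

  cross-+ : ∀ a b → (+ a ℤ.* + 12 ℤ.+ + b ℤ.* + 12) ℤ.* + 12 ≡ + (a + b) ℤ.* + 144
  cross-+ a b = trans (cong (ℤ._* + 12) (trans (cong₂ ℤ._+_ (sym (ℤP.pos-* a 12)) (sym (ℤP.pos-* b 12)))
                                             (sym (ℤP.pos-+ (a * 12) (b * 12)))))
                (trans (sym (ℤP.pos-* (a * 12 + b * 12) 12))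
                (trans (cong +_ (trans (cong (_* 12) (sym (ℕP.*-distribʳ-+ 12 a b))) (ℕP.*-assoc (a + b) 12 12)))
                       (ℤP.pos-* (a + b) 144)))

twelfths-+ : ∀ a b → twelfths a Q.+ twelfths b ≡ twelfths (a + b)
twelfths-+ a b = ℚP.toℚᵘ-injective
  (ℚᵘP.≃-trans (ℚP.toℚᵘ-homo-+ (twelfths a) (twelfths b))
  (ℚᵘP.≃-trans (ℚᵘP.+-cong (as-ℚᵘ a) (as-ℚᵘ b))
  (ℚᵘP.≃-trans (*≡* (cross-+ a b)) (ℚᵘP.≃-sym (as-ℚᵘ (a + b))))))

twelfths-mono : ∀ {a b} → a ≤ b → twelfths a Q.≤ twelfths b
twelfths-mono {a} {b} a≤b = ℚP.toℚᵘ-cancel-≤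
  (ℚᵘP.≤-respˡ-≃ (ℚᵘP.≃-sym (as-ℚᵘ a)) (ℚᵘP.≤-respʳ-≃ (ℚᵘP.≃-sym (as-ℚᵘ b))
    (*≤* (ℤP.≤-trans (ℤP.≤-reflexive (sym (ℤP.pos-* a 12)))
         (ℤP.≤-trans (ℤ.+≤+ (ℕP.*-monoˡ-≤ 12 a≤b)) (ℤP.≤-reflexive (ℤP.pos-* b 12)))))))

inv≤u : ∀ k → inv k Q.≤ twelfths (u k)
inv≤u 0 = ℚP.≤-refl
inv≤u 1 = ℚP.≤-refl
inv≤u 2 = ℚP.≤-refl
inv≤u 3 = ℚP.≤-refl
inv≤u (suc (suc (suc (suc k)))) = ℚP.toℚᵘ-cancel-≤
  (ℚᵘP.≤-respˡ-≃ (ℚᵘP.≃-sym (ℚP.toℚᵘ-fromℚᵘ (mkℚᵘ (+ 1) (3 + k))))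
  (ℚᵘP.≤-respʳ-≃ (ℚᵘP.≃-sym (as-ℚᵘ 3))
  (*≤* (ℤ.+≤+ (ℕP.*-monoʳ-≤ 3 (ℕP.m≤m+n 4 k))))))

weights<3 : ∀ {A : Set} (c : A → ℕ) (L : List A) → sum (map (λ t → u (c t)) L) ≤ 35 →
  sumℚ (map (λ t → inv (c t)) L) Q.< (+ 3) Q./ 1
weights<3 c L ≤35 = ℚP.≤-<-trans (in-twelfths L) (ℚP.≤-<-trans (twelfths-mono ≤35) 35/12<3)
  where
  in-twelfths : ∀ L → sumℚ (map (λ t → inv (c t)) L) Q.≤ twelfths (sum (map (λ t → u (c t)) L))
  in-twelfths [] = ℚP.≤-refl
  in-twelfths (x ∷ L) = ℚP.≤-trans (ℚP.+-mono-≤ (inv≤u (c x)) (in-twelfths L))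
                                   (ℚP.≤-reflexive (twelfths-+ (u (c x)) _))
  35/12<3 : twelfths 35 Q.< (+ 3) Q./ 1
  35/12<3 = ℚP.toℚᵘ-cancel-< (*<* (ℤ.+<+ ℕP.≤-refl))


-- The weighted count of the six kinds of edges conflicting with e: far edges with
-- |C| = 1, 2, ≥ 3 (weights 12, 6, 4) and near edges with |C| = 2, 3, ≥ 4 (weights 6, 4, 3).
weighted : (a b c d f g : ℕ) → ℕ
weighted a b c d f g = (12 * a + (6 * b + 4 * c)) + (6 * d + (4 * f + 3 * g))

Exceptional : (a b c d f g : ℕ) → Set
Exceptional a b c d f g = a ≡ 1 × b ≡ 1 × c ≡ 0 × d ≡ 1 × f ≡ 3 × g ≡ 0

private
  scaled : ∀ {p q x y n} → q ≤ p → x + y ≤ n → p * x + q * y ≤ p * n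
  scaled {p} {q} {x} {y} {n} q≤p x+y≤n = begin
    p * x + q * y  ≤⟨ ℕP.+-monoʳ-≤ (p * x) (ℕP.*-monoˡ-≤ y q≤p) ⟩
    p * x + p * y  ≡⟨ sym (ℕP.*-distribˡ-+ p x y) ⟩
    p * (x + y)    ≤⟨ ℕP.*-monoʳ-≤ p x+y≤n ⟩
    p * n          ∎
    where open ℕP.≤-Reasoning

  both-scaled : ∀ A D {b c f g kF kN} → b + c ≤ kF → f + g ≤ kN →
    (A + (6 * b + 4 * c)) + (D + (4 * f + 3 * g)) ≤ (A + 6 * kF) + (D + 4 * kN)
  both-scaled A D {b} {c} {f} {g} hF hN =
    ℕP.+-mono-≤ (ℕP.+-monoʳ-≤ A (scaled {6} {4} {b} {c} (ℕP.≤ᵇ⇒≤ 4 6 _) hF))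
                (ℕP.+-monoʳ-≤ D (scaled {4} {3} {f} {g} (ℕP.≤ᵇ⇒≤ 3 4 _) hN))

  tight-far : ∀ {b c} → b + c ≤ 1 → 6 * b + 4 * c ≤ 5 ⊎ (b ≡ 1 × c ≡ 0)
  tight-far {0} c≤1 = inj₁ (ℕP.≤-trans (ℕP.*-monoʳ-≤ 4 c≤1) (ℕP.≤ᵇ⇒≤ 4 5 _))
  tight-far {1} {0} _ = inj₂ (refl , refl)
  tight-far {1} {suc _} (s≤s ())
  tight-far {suc (suc _)} (s≤s ())

  tight-near : ∀ {f g} → f + g ≤ 3 → 4 * f + 3 * g ≤ 11 ⊎ (f ≡ 3 × g ≡ 0)
  tight-near {0} g≤3 = inj₁ (ℕP.≤-trans (ℕP.*-monoʳ-≤ 3 g≤3) (ℕP.≤ᵇ⇒≤ 9 11 _))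
  tight-near {1} (s≤s g≤2) = inj₁ (ℕP.≤-trans (ℕP.+-monoʳ-≤ 4 (ℕP.*-monoʳ-≤ 3 g≤2)) (ℕP.≤ᵇ⇒≤ 10 11 _))
  tight-near {2} (s≤s (s≤s g≤1)) = inj₁ (ℕP.+-monoʳ-≤ 8 (ℕP.*-monoʳ-≤ 3 g≤1))
  tight-near {3} {0} _ = inj₂ (refl , refl)
  tight-near {3} {suc _} (s≤s (s≤s (s≤s ())))
  tight-near {suc (suc (suc (suc _)))} (s≤s (s≤s (s≤s ())))

count-bound : ∀ {a b c d f g} → a ≤ 1 → d ≤ 2 → (1 ≤ a → d ≤ 1) →
  a + (b + c) ≤ 2 → d + (f + g) ≤ 4 → weighted a b c d f g ≤ 35 ⊎ Exceptional a b c d f g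
count-bound {b = b} {c} {f = f} {g} z≤n z≤n _ hF hN =
  inj₁ (ℕP.≤-trans (both-scaled 0 0 {b} {c} {f} {g} hF hN) (ℕP.≤ᵇ⇒≤ 28 35 _))
count-bound {b = b} {c} {f = f} {g} z≤n (s≤s z≤n) _ hF (s≤s hN) =
  inj₁ (ℕP.≤-trans (both-scaled 0 6 {b} {c} {f} {g} hF hN) (ℕP.≤ᵇ⇒≤ 30 35 _))
count-bound {b = b} {c} {f = f} {g} z≤n (s≤s (s≤s z≤n)) _ hF (s≤s (s≤s hN)) =
  inj₁ (ℕP.≤-trans (both-scaled 0 12 {b} {c} {f} {g} hF hN) (ℕP.≤ᵇ⇒≤ 32 35 _))
count-bound {b = b} {c} {f = f} {g} (s≤s z≤n) z≤n _ (s≤s hF) hN =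
  inj₁ (ℕP.≤-trans (both-scaled 12 0 {b} {c} {f} {g} hF hN) (ℕP.≤ᵇ⇒≤ 34 35 _))
count-bound (s≤s z≤n) (s≤s (s≤s z≤n)) excess _ _ with excess (s≤s z≤n)
... | s≤s ()
count-bound {b = b} {c} {f = f} {g} (s≤s z≤n) (s≤s z≤n) _ (s≤s hF) (s≤s hN)
  with tight-far {b} {c} hF | tight-near {f} {g} hN
... | inj₁ F≤5 | _ =
  inj₁ (ℕP.+-mono-≤ (ℕP.+-monoʳ-≤ 12 F≤5) (ℕP.+-monoʳ-≤ 6 (scaled {4} {3} {f} {g} (ℕP.≤ᵇ⇒≤ 3 4 _) hN)))
... | inj₂ (refl , refl) | inj₁ N≤11 = inj₁ (ℕP.+-monoʳ-≤ 18 (ℕP.+-monoʳ-≤ 6 N≤11))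
... | inj₂ (refl , refl) | inj₂ (refl , refl) = inj₂ (refl , refl , refl , refl , refl , refl)


module Counting {m : ℕ} (E M M* : List (Edge m)) (cmM : IsCompatibleMatching E M)
                (fails : Replace5by6Fails E M) (cm* : IsCompatibleMatching E M*)
                (e e' : Edge m) (e∈M : e ∈ M) (e'∈M : e' ∈ M) (par : Parallel e e') (e∉M* : e ∉ M*) where

  pcM* = proj₂ cm*

  T : List (Edge m)
  T = C*set M* e

  c : Edge m → ℕ
  c t = length (Cset M t)

  T⊆M* : ∀ {t} → t ∈ T → t ∈ M*
  T⊆M* = filter-⊆ (λ t → ConflictingSelf? t e) M*

  uT : Unique T
  uT = Unique.filter⁺ _ (proj₁ pcM*)

  T-conflicts : ∀ {t} → t ∈ T → Conflicting t e
  T-conflicts t∈ with filter-sat (λ t → ConflictingSelf? t e) M* t∈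
  ... | inj₁ refl = ⊥-elim (e∉M* (T⊆M* t∈))
  ... | inj₂ conflict = conflict

  T∉M : ∀ {t} → t ∈ T → t ∉ M
  T∉M t∈ t∈M = members-compatible (proj₂ cmM) t∈M e∈M (T-conflicts t∈)

  ∈C : ∀ {t f} → f ∈ M → Conflicting t f → f ∈ Cset M t
  ∈C {t} f∈M conflict = ∈-filter⁺ (ConflictingSelf? t) f∈M (inj₂ conflict)

  C⊆M : ∀ {t f} → f ∈ Cset M t → f ∈ M
  C⊆M {t} = filter-⊆ (ConflictingSelf? t) M

  e∈C : ∀ {t} → t ∈ T → e ∈ Cset M t
  e∈C t∈ = ∈C e∈M (T-conflicts t∈)

  no-exchange : (K Y : List (Edge m)) → length K ≤ 5 → length K ℕ.< length Y → Unique Y →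
    (∀ {y} → y ∈ Y → y ∈ T) → (∀ {y f} → y ∈ Y → f ∈ Cset M y → f ∈ K) → ⊥
  no-exchange K Y K≤5 K<Y uY Y⊆T confined =
    Exchange.contradiction E M cmM fails M* cm* K Y K≤5 K<Y uY (All.tabulate (T⊆M* ∘ Y⊆T))
      (λ y∈ → lose e∈M (T-conflicts (Y⊆T y∈))) (λ y∈ f∈M c → confined y∈ (∈C f∈M c))

  N F : List (Edge m)
  N = filter (Near? e e') T
  F = filter (¬? ∘ Near? e e') T

  N⊆T : ∀ {t} → t ∈ N → t ∈ T
  N⊆T = filter-⊆ (Near? e e') T

  F⊆T : ∀ {t} → t ∈ F → t ∈ T
  F⊆T = filter-⊆ (¬? ∘ Near? e e') T

  near-or-far-in-T : ∀ {t} → t ∈ T → t ∈ N ⊎ t ∈ F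
  near-or-far-in-T {t} t∈ with Near? e e' t
  ... | yes near = inj₁ (∈-filter⁺ (Near? e e') t∈ near)
  ... | no ¬near = inj₂ (∈-filter⁺ (¬? ∘ Near? e e') t∈ ¬near)

  ee' : List (Edge m)
  ee' = e ∷ e' ∷ []

  u-ee' : Unique ee'
  u-ee' = ((parallel⇒distinct par) ∷ []) ∷ [] ∷ []

  ee'⊆C : ∀ {t} → t ∈ N → All (_∈ Cset M t) ee'
  ee'⊆C t∈ = e∈C (N⊆T t∈) ∷ ∈C e'∈M (near⇒conflicts' e e' _ par (T-conflicts (N⊆T t∈)) (filter-sat (Near? e e') T t∈)) ∷ []

  near-c≥2 : ∀ {t} → t ∈ N → 2 ≤ c t
  near-c≥2 {t} t∈ = unique-⊆⇒length≤ _≟E_ ee' (Cset M t) u-ee' (ee'⊆C t∈)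

  C-conflicts : ∀ {t f} → t ∈ T → f ∈ Cset M t → Conflicting t f
  C-conflicts {t} t∈ f∈ with filter-sat (ConflictingSelf? t) M f∈
  ... | inj₁ refl = ⊥-elim (T∉M t∈ (C⊆M f∈))
  ... | inj₂ conflict = conflict

  -- Every far edge is A-far or B-far and every near edge occupies one of four
  -- positions; each position holds at most one edge of M*.
  open Covering (_∈ M*) using (Class; Singular; InSome; covered-length; covered-witnesses)

  far-classes near-classes : List Class
  far-classes = (FarA e e' , FarA? e e') ∷ (FarB e e' , FarB? e e') ∷ []
  near-classes = ((λ t → vA t ≡ vA e)  , (λ t → vA t ℕP.≟ vA e))
               ∷ ((λ t → vA t ≡ vA e') , (λ t → vA t ℕP.≟ vA e'))
               ∷ ((λ t → vB t ≡ vB e)  , (λ t → vB t ℕP.≟ vB e))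
               ∷ ((λ t → vB t ≡ vB e') , (λ t → vB t ℕP.≟ vB e')) ∷ []

  far-singular : All Singular far-classes
  far-singular = (λ {s} {t} s∈ t∈ p q → same-A pcM* s∈ t∈ (farA-index e e' s t par p q))
               ∷ (λ {s} {t} s∈ t∈ p q → same-B pcM* s∈ t∈ (farB-index e e' s t par p q)) ∷ []

  near-singular : All Singular near-classes
  near-singular = (λ s∈ t∈ p q → same-A pcM* s∈ t∈ (trans p (sym q)))
                ∷ (λ s∈ t∈ p q → same-A pcM* s∈ t∈ (trans p (sym q)))
                ∷ (λ s∈ t∈ p q → same-B pcM* s∈ t∈ (trans p (sym q)))
                ∷ (λ s∈ t∈ p q → same-B pcM* s∈ t∈ (trans p (sym q))) ∷ []

  far-covered : All (InSome far-classes) F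
  far-covered = All.tabulate λ t∈ →
    [ here , there ∘ here ]′ (near-or-far e e' _ (T-conflicts (F⊆T t∈)) (filter-sat (¬? ∘ Near? e e') T t∈))

  near-covered : All (InSome near-classes) N
  near-covered = All.tabulate λ t∈ → position (filter-sat (Near? e e') T t∈)
    where
    position : ∀ {t} → Near e e' t → InSome near-classes t
    position (inj₁ p) = here p
    position (inj₂ (inj₁ p)) = there (here p)
    position (inj₂ (inj₂ (inj₁ p))) = there (there (here p))
    position (inj₂ (inj₂ (inj₂ p))) = there (there (there (here p)))

  uF : Unique F
  uF = Unique.filter⁺ _ uT

  uN : Unique N
  uN = Unique.filter⁺ _ uT

  F⊆M* : All (_∈ M*) F
  F⊆M* = All.tabulate (T⊆M* ∘ F⊆T)

  N⊆M* : All (_∈ M*) N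
  N⊆M* = All.tabulate (T⊆M* ∘ N⊆T)

  |F|≤2 : length F ≤ 2
  |F|≤2 = covered-length far-classes F uF F⊆M* far-singular far-covered

  |N|≤4 : length N ≤ 4
  |N|≤4 = covered-length near-classes N uN N⊆M* near-singular near-covered

  c≡? : (k : ℕ) → Decidable (λ t → c t ≡ k)
  c≡? k t = c t ℕP.≟ k

  F₁ F' F₂ F₃ N₂ N' N₃ N₄ : List (Edge m)
  F₁ = filter (c≡? 1) F
  F' = filter (¬? ∘ c≡? 1) F
  F₂ = filter (c≡? 2) F'
  F₃ = filter (¬? ∘ c≡? 2) F'
  N₂ = filter (c≡? 2) N
  N' = filter (¬? ∘ c≡? 2) N
  N₃ = filter (c≡? 3) N'
  N₄ = filter (¬? ∘ c≡? 3) N'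

  a b c' d f g : ℕ
  a = length F₁
  b = length F₂
  c' = length F₃
  d = length N₂
  f = length N₃
  g = length N₄

  |F| : length F ≡ a + (b + c')
  |F| = length-split₃ (c≡? 1) (c≡? 2) F

  |N| : length N ≡ d + (f + g)
  |N| = length-split₃ (c≡? 2) (c≡? 3) N

  far-sum : sum (map (u ∘ c) F) ≤ 12 * a + (6 * b + 4 * c')
  far-sum = ℕP.≤-trans (ℕP.≤-reflexive (sum-split₃ (c≡? 1) (c≡? 2) (u ∘ c) F))
    (ℕP.+-mono-≤ (sum-≤ (u ∘ c) 12 F₁ (λ _ → u≤12 _))
    (ℕP.+-mono-≤ (sum-≤ (u ∘ c) 6 F₂ (λ t∈ → ℕP.≤-reflexive (cong u (filter-sat (c≡? 2) F' t∈))))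
                 (sum-≤ (u ∘ c) 4 F₃ (λ t∈ → u≤4 _ (filter-sat (¬? ∘ c≡? 1) F (filter-⊆ (¬? ∘ c≡? 2) F' t∈))
                                                  (filter-sat (¬? ∘ c≡? 2) F' t∈)))))

  near-sum : sum (map (u ∘ c) N) ≤ 6 * d + (4 * f + 3 * g)
  near-sum = ℕP.≤-trans (ℕP.≤-reflexive (sum-split₃ (c≡? 2) (c≡? 3) (u ∘ c) N))
    (ℕP.+-mono-≤ (sum-≤ (u ∘ c) 6 N₂ (λ t∈ → ℕP.≤-reflexive (cong u (filter-sat (c≡? 2) N t∈))))
    (ℕP.+-mono-≤ (sum-≤ (u ∘ c) 4 N₃ (λ t∈ → ℕP.≤-reflexive (cong u (filter-sat (c≡? 3) N' t∈))))
                 (sum-≤ (u ∘ c) 3 N₄ (λ t∈ → let t∈N' = filter-⊆ (¬? ∘ c≡? 3) N' t∈ in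
                                             u≤3 _ (near-c≥2 (filter-⊆ (¬? ∘ c≡? 2) N t∈N'))
                                                   (filter-sat (¬? ∘ c≡? 2) N t∈N')
                                                   (filter-sat (¬? ∘ c≡? 3) N' t∈)))))

  T-sum : sum (map (u ∘ c) T) ≤ weighted a b c' d f g
  T-sum = ℕP.≤-trans (ℕP.≤-reflexive (sum-split (Near? e e') (u ∘ c) T))
          (ℕP.≤-trans (ℕP.+-mono-≤ near-sum far-sum) (ℕP.≤-reflexive (ℕP.+-comm (6 * d + (4 * f + 3 * g)) (12 * a + (6 * b + 4 * c')))))

  F₁-confined : ∀ {t z} → t ∈ F₁ → z ∈ Cset M t → z ∈ e ∷ []
  F₁-confined {t} t∈ = squeezed _≟E_ (e ∷ []) (Cset M t) ([] ∷ []) (e∈C (F⊆T (filter-⊆ (c≡? 1) F t∈)) ∷ [])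
                         (ℕP.≤-reflexive (filter-sat (c≡? 1) F t∈))

  N₂-confined : ∀ {t z} → t ∈ N₂ → z ∈ Cset M t → z ∈ ee'
  N₂-confined {t} t∈ = squeezed _≟E_ ee' (Cset M t) u-ee' (ee'⊆C (filter-⊆ (c≡? 2) N t∈))
                         (ℕP.≤-reflexive (filter-sat (c≡? 2) N t∈))

  ⊆ee' : ∀ {z} → z ∈ e ∷ [] → z ∈ ee'
  ⊆ee' (here p) = here p

  F₁⊆T : ∀ {t} → t ∈ F₁ → t ∈ T
  F₁⊆T = F⊆T ∘ filter-⊆ (c≡? 1) F

  N₂⊆T : ∀ {t} → t ∈ N₂ → t ∈ T
  N₂⊆T = N⊆T ∘ filter-⊆ (c≡? 2) N

  a≤1 : a ≤ 1
  a≤1 = ℕP.≮⇒≥ λ 1<a → no-exchange (e ∷ []) F₁ (s≤s z≤n) 1<a (Unique.filter⁺ _ uF) F₁⊆T F₁-confined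

  d≤2 : d ≤ 2
  d≤2 = ℕP.≮⇒≥ λ 2<d → no-exchange ee' N₂ (s≤s (s≤s z≤n)) 2<d (Unique.filter⁺ _ uN) N₂⊆T N₂-confined

  a≥1⇒d≤1 : 1 ≤ a → d ≤ 1
  a≥1⇒d≤1 1≤a = ℕP.≮⇒≥ λ 1<d →
    no-exchange ee' (F₁ ++ N₂) (s≤s (s≤s z≤n))
      (ℕP.≤-trans (ℕP.+-mono-≤ 1≤a 1<d) (ℕP.≤-reflexive (sym (length-++ F₁))))
      (Unique.++⁺ (Unique.filter⁺ _ uF) (Unique.filter⁺ _ uN)
        (λ (far , near) → filter-sat (¬? ∘ Near? e e') T (filter-⊆ (c≡? 1) F far)
                            (filter-sat (Near? e e') T (filter-⊆ (c≡? 2) N near))))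
      (λ y∈ → [ F₁⊆T , N₂⊆T ]′ (∈-++⁻ F₁ y∈))
      (λ y∈ → [ (λ y∈F₁ → ⊆ee' ∘ F₁-confined y∈F₁) , N₂-confined ]′ (∈-++⁻ F₁ y∈))

  -- The exceptional profile: two far edges, one with c = 1 and one (φ₂) with c = 2, and
  -- four near edges with c ≤ 3.  All M-conflicts of T then lie in the five edges e, e',
  -- the second conflict f₀ of φ₂ and the third conflicts of the near edges α₁ (at the
  -- D^A-index of e') and β₁ (at the D^B-index of e'); the other two near edges are the
  -- middle edges of chains of three consecutive parallel edges of M*.  With |T| = 6 this
  -- contradicts the exchange principle.
  module Exceptional-profile (a≡1 : a ≡ 1) (b≡1 : b ≡ 1) (c'≡0 : c' ≡ 0)
                             (d≡1 : d ≡ 1) (f≡3 : f ≡ 3) (g≡0 : g ≡ 0) where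

    |F|≡2 : length F ≡ 2
    |F|≡2 = trans |F| (cong₂ _+_ a≡1 (cong₂ _+_ b≡1 c'≡0))

    |N|≡4 : length N ≡ 4
    |N|≡4 = trans |N| (cong₂ _+_ d≡1 (cong₂ _+_ f≡3 g≡0))

    |T|≡6 : length T ≡ 6
    |T|≡6 = trans (length-split (Near? e e') T) (cong₂ _+_ |N|≡4 |F|≡2)

    φ₂ : Edge m
    φ₂ = proj₁ (nonempty F₂ (ℕP.≤-reflexive (sym b≡1)))

    φ₂∈F₂ : φ₂ ∈ F₂
    φ₂∈F₂ = proj₂ (nonempty F₂ (ℕP.≤-reflexive (sym b≡1)))

    far-shape : ∀ {t} → t ∈ F → c t ≡ 1 ⊎ t ≡ φ₂
    far-shape {t} t∈ = [ inj₁ , inj₂ ∘ heavier ∘ ∈-filter⁺ (¬? ∘ c≡? 1) t∈ ]′ (toSum (c≡? 1 t))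
      where
      at-φ₂ : ∀ {x} → x ∈ F₂ → x ≡ pick F₂ φ₂
      at-φ₂ = length≤1⇒pick F₂ (ℕP.≤-reflexive b≡1)
      heavier : t ∈ F' → t ≡ φ₂
      heavier t∈F' = [ (λ c≡2 → trans (at-φ₂ (∈-filter⁺ (c≡? 2) t∈F' c≡2)) (sym (at-φ₂ φ₂∈F₂))) ,
                       (λ c≢2 → ⊥-elim (length≤0⇒∉ F₃ (ℕP.≤-reflexive c'≡0) (∈-filter⁺ (¬? ∘ c≡? 2) t∈F' c≢2))) ]′
                     (toSum (c≡? 2 t))

    φ₂∈F : φ₂ ∈ F
    φ₂∈F = filter-⊆ (¬? ∘ c≡? 1) F (filter-⊆ (c≡? 2) F' φ₂∈F₂)

    second : ∃[ f₀ ] (f₀ ∈ Cset M φ₂ × (∀ {z} → z ∈ Cset M φ₂ → z ∈ e ∷ [] ⊎ z ≡ f₀))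
    second = one-more _≟E_ (e ∷ []) (Cset M φ₂) (e∈C (F⊆T φ₂∈F)) ([] ∷ []) (e∈C (F⊆T φ₂∈F) ∷ [])
               (ℕP.≤-reflexive (filter-sat (c≡? 2) F' φ₂∈F₂))

    near-c≤3 : ∀ {t} → t ∈ N → c t ≤ 3
    near-c≤3 {t} t∈ = [ (λ c≡2 → ℕP.≤-trans (ℕP.≤-reflexive c≡2) (ℕP.n≤1+n 2)) , not-two ]′ (toSum (c≡? 2 t))
      where
      not-two : c t ≢ 2 → c t ≤ 3
      not-two c≢2 = [ ℕP.≤-reflexive ,
                      (λ c≢3 → ⊥-elim (length≤0⇒∉ N₄ (ℕP.≤-reflexive g≡0)
                                 (∈-filter⁺ (¬? ∘ c≡? 3) (∈-filter⁺ (¬? ∘ c≡? 2) t∈ c≢2) c≢3))) ]′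
                    (toSum (c≡? 3 t))

    third : ∀ {t} → t ∈ N → ∃[ g ] (g ∈ Cset M t × (∀ {z} → z ∈ Cset M t → z ∈ ee' ⊎ z ≡ g))
    third {t} t∈ = one-more _≟E_ ee' (Cset M t) (e∈C (N⊆T t∈)) u-ee' (ee'⊆C t∈) (near-c≤3 t∈)

    far-witnesses : All (λ P → ∃[ x ] (x ∈ F × proj₁ P x)) far-classes
    far-witnesses = covered-witnesses far-classes F uF F⊆M* far-singular far-covered (ℕP.≤-reflexive (sym |F|≡2))

    near-witnesses : All (λ P → ∃[ x ] (x ∈ N × proj₁ P x)) near-classes
    near-witnesses = covered-witnesses near-classes N uN N⊆M* near-singular near-covered (ℕP.≤-reflexive (sym |N|≡4))

    module Occupied (φA φB α₀ α₁ β₀ β₁ : Edge m)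
                    (φA∈ : φA ∈ F) (farA : FarA e e' φA) (φB∈ : φB ∈ F) (farB : FarB e e' φB)
                    (α₀∈ : α₀ ∈ N) (α₀-A : vA α₀ ≡ vA e) (α₁∈ : α₁ ∈ N) (α₁-A : vA α₁ ≡ vA e')
                    (β₀∈ : β₀ ∈ N) (β₀-B : vB β₀ ≡ vB e) (β₁∈ : β₁ ∈ N) (β₁-B : vB β₁ ≡ vB e') where

      K : List (Edge m)
      K = e ∷ e' ∷ proj₁ second ∷ proj₁ (third α₁∈) ∷ proj₁ (third β₁∈) ∷ []

      ee'⊆K : ∀ {z} → z ∈ ee' → z ∈ K
      ee'⊆K (here p) = here p
      ee'⊆K (there (here p)) = there (here p)

      φ₂-confined : ∀ {z} → z ∈ Cset M φ₂ → z ∈ K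
      φ₂-confined z∈ = [ ee'⊆K ∘ ⊆ee' , there ∘ there ∘ here ]′ (proj₂ (proj₂ second) z∈)

      far-confined : ∀ {t z} → t ∈ F → z ∈ Cset M t → z ∈ K
      far-confined {t} {z} t∈ z∈ =
        [ (λ c≡1 → ee'⊆K (⊆ee' (F₁-confined (∈-filter⁺ (c≡? 1) t∈ c≡1) z∈))) ,
          (λ t≡φ₂ → φ₂-confined (subst (λ x → z ∈ Cset M x) t≡φ₂ z∈)) ]′ (far-shape t∈)

      α₁-confined : ∀ {z} → z ∈ Cset M α₁ → z ∈ K
      α₁-confined z∈ = [ ee'⊆K , there ∘ there ∘ there ∘ here ]′ (proj₂ (proj₂ (third α₁∈)) z∈)

      β₁-confined : ∀ {z} → z ∈ Cset M β₁ → z ∈ K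
      β₁-confined z∈ = [ ee'⊆K , there ∘ there ∘ there ∘ there ∘ here ]′ (proj₂ (proj₂ (third β₁∈)) z∈)

      -- φA, α₀, α₁ (and φB, β₀, β₁) are consecutive parallel edges of M*
      α₀-confined : ∀ {z} → z ∈ Cset M α₀ → z ∈ K
      α₀-confined {z} z∈ =
        [ far-confined φA∈ ∘ ∈C (C⊆M z∈) ∘ conflict-sym , α₁-confined ∘ ∈C (C⊆M z∈) ∘ conflict-sym ]′
          (far-chain-A pcM* e e' par (T⊆M* (F⊆T φA∈)) (T⊆M* (N⊆T α₀∈)) (T⊆M* (N⊆T α₁∈)) farA α₀-A α₁-A z
             (conflict-sym (C-conflicts (N⊆T α₀∈) z∈)))

      β₀-confined : ∀ {z} → z ∈ Cset M β₀ → z ∈ K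
      β₀-confined {z} z∈ =
        [ far-confined φB∈ ∘ ∈C (C⊆M z∈) ∘ conflict-sym , β₁-confined ∘ ∈C (C⊆M z∈) ∘ conflict-sym ]′
          (far-chain-B pcM* e e' par (T⊆M* (F⊆T φB∈)) (T⊆M* (N⊆T β₀∈)) (T⊆M* (N⊆T β₁∈)) farB β₀-B β₁-B z
             (conflict-sym (C-conflicts (N⊆T β₀∈) z∈)))

      -- a near edge is the edge of M* at its position
      near-confined : ∀ {t z} → t ∈ N → z ∈ Cset M t → z ∈ K
      near-confined {t} {z} t∈ z∈ = at (filter-sat (Near? e e') T t∈)
        where
        t∈M* = T⊆M* (N⊆T t∈)
        moved : ∀ {x} → t ≡ x → z ∈ Cset M x
        moved refl = z∈
        at : Near e e' t → z ∈ K
        at (inj₁ p) = α₀-confined (moved (same-A pcM* t∈M* (T⊆M* (N⊆T α₀∈)) (trans p (sym α₀-A))))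
        at (inj₂ (inj₁ p)) = α₁-confined (moved (same-A pcM* t∈M* (T⊆M* (N⊆T α₁∈)) (trans p (sym α₁-A))))
        at (inj₂ (inj₂ (inj₁ p))) = β₀-confined (moved (same-B pcM* t∈M* (T⊆M* (N⊆T β₀∈)) (trans p (sym β₀-B))))
        at (inj₂ (inj₂ (inj₂ p))) = β₁-confined (moved (same-B pcM* t∈M* (T⊆M* (N⊆T β₁∈)) (trans p (sym β₁-B))))

      contradiction : ⊥
      contradiction = no-exchange K T ℕP.≤-refl (ℕP.≤-reflexive (sym |T|≡6)) uT (λ t∈ → t∈)
        λ t∈ → [ near-confined , far-confined ]′ (near-or-far-in-T t∈)

    contradiction : ⊥
    contradiction = occupied far-witnesses near-witnesses
      where
      occupied : All (λ P → ∃[ x ] (x ∈ F × proj₁ P x)) far-classes →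
                 All (λ P → ∃[ x ] (x ∈ N × proj₁ P x)) near-classes → ⊥
      occupied ((φA , φA∈ , farA) ∷ (φB , φB∈ , farB) ∷ [])
               ((α₀ , α₀∈ , α₀-A) ∷ (α₁ , α₁∈ , α₁-A) ∷ (β₀ , β₀∈ , β₀-B) ∷ (β₁ , β₁∈ , β₁-B) ∷ []) =
        Occupied.contradiction φA φB α₀ α₁ β₀ β₁ φA∈ farA φB∈ farB α₀∈ α₀-A α₁∈ α₁-A β₀∈ β₀-B β₁∈ β₁-B

  scaled-weight≤35 : sum (map (u ∘ c) T) ≤ 35
  scaled-weight≤35 =
    [ ℕP.≤-trans T-sum ,
      (λ (a≡1 , b≡1 , c'≡0 , d≡1 , f≡3 , g≡0) → ⊥-elim (Exceptional-profile.contradiction a≡1 b≡1 c'≡0 d≡1 f≡3 g≡0)) ]′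
    (count-bound {a} {b} {c'} {d} {f} {g} a≤1 d≤2 a≥1⇒d≤1
       (ℕP.≤-trans (ℕP.≤-reflexive (sym |F|)) |F|≤2) (ℕP.≤-trans (ℕP.≤-reflexive (sym |N|)) |N|≤4))

weight-of-matched≤35 : ∀ {m} (M M* : List (Edge m)) → PairwiseCompatible M* → ∀ {e} → e ∈ M* →
  sum (map (λ t → u (length (Cset M t))) (C*set M* e)) ≤ 35
weight-of-matched≤35 M M* pcM* {e} e∈M* =
  ℕP.≤-trans (sum-≤ (λ t → u (length (Cset M t))) 12 T (λ _ → u≤12 _))
             (ℕP.≤-trans (ℕP.*-monoʳ-≤ 12 |T|≤1) (ℕP.≤ᵇ⇒≤ 12 35 _))
  where
  T = C*set M* e
  is-e : ∀ {t} → t ∈ T → t ≡ e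
  is-e t∈ = [ (λ t≡e → t≡e) ,
              (λ conflict → ⊥-elim (members-compatible pcM* (filter-⊆ (λ t → ConflictingSelf? t e) M* t∈) e∈M* conflict)) ]′
            (filter-sat (λ t → ConflictingSelf? t e) M* t∈)
  |T|≤1 : length T ≤ 1
  |T|≤1 = all-equal⇒length≤1 T (Unique.filter⁺ _ (proj₁ pcM*)) (λ s∈ t∈ → trans (is-e s∈) (sym (is-e t∈)))

parallel-scaled-weight≤35 : ∀ {m} (E M M* : List (Edge m)) → IsCompatibleMatching E M → Replace5by6Fails E M →
  IsCompatibleMatching E M* → ∀ {e e'} → e ∈ M → e' ∈ M → Parallel e e' →
  sum (map (λ t → u (length (Cset M t))) (C*set M* e)) ≤ 35
parallel-scaled-weight≤35 E M M* cmM fails cm* {e} {e'} e∈M e'∈M par =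
  [ weight-of-matched≤35 M M* (proj₂ cm*) ,
    Counting.scaled-weight≤35 E M M* cmM fails cm* e e' e∈M e'∈M par ]′ (toSum (e ∈? M*))

lemma4p10 : ∀ {m} (E M M* : List (Edge m))
    → IsLSOutput E M
    → IsMaximumCM E M*
    → ∀ e → IsParallelEdge M e
    → ω M M* e < (+ 3) Q./ 1
lemma4p10 E M M* ((cmM , _) , fails , _) (cm* , _) e (e∈M , parallel-to-some) =
  let (e' , e'∈M , par) = find parallel-to-some in
  weights<3 (λ t → length (Cset M t)) (C*set M* e)
    (parallel-scaled-weight≤35 E M M* cmM fails cm* e∈M e'∈M par)
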